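{- Let $p, n \in \mathbb{N}$ and $k \in \mathbb{N}_0$ with $0 \le k \le p$. Then $$H_{n}^{(p)}=\sum_{j=1}^{k}(-1)^{j-1}\sum_{\ell=1}^{n}\frac{n+1}{\ell^{j}(n+1-\ell)^{p+1-j}}+(-1)^{k}\sum_{\ell=1}^{n}\frac{1}{\ell^{k}(n+1-\ell)^{p-k}}.$$ In particular, for every $m \in \mathbb{N}_0$ and $n\in\mathbb{N}$, $$H_{n}^{(2m+1)}=\sum_{j=1}^{m}(-1)^{j-1}\sum_{k=1}^{n-1}\frac{n}{k^{j}(n-k)^{2m+2-j}}+\frac{(-1)^{m}}{2}\sum_{k=1}^{n-1}\frac{n}{k^{m+1}(n-k)^{m+1}}+\frac{1}{n^{2m+1}},$$ $$H_{n}^{(2m)}=\sum_{j=1}^{m}(-1)^{j-1}\sum_{k=1}^{n-1}\frac{n}{k^{j}(n-k)^{2m+1-j}}+(-1)^{m}\sum_{j=1}^{n-1}\frac{1}{j^{m}(n-j)^{m}}+\frac{1}{n^{2m}}.$$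
   Context: For $n\in\mathbb{N}$ and $m\in\mathbb{N}_0$, $H_n^{(m)}=\sum_{j=1}^n j^{ -m}$ (so $H_n^{(0)}=n$). Empty sums are $0$. -}

module Defs where

open import Data.Nat using (ℕ; zero; suc)
open import Data.Integer using (+_)
open import Data.Rational using (ℚ; 0ℚ; 1ℚ; _+_; -_; _/_)

ℕ→ℚ : ℕ → ℚ
ℕ→ℚ n = + n / 1

-- reciprocal 1/d of a natural number d; only ever applied to d ≠ 0
-- (convention recip 0 = 0 is never used in the statement)
recip : ℕ → ℚ
recip zero    = 0ℚ
recip (suc d) = + 1 / suc d

sgn : ℕ → ℚ
sgn zero    = 1ℚ
sgn (suc j) = - sgn j

Σ₁ : ℕ → (ℕ → ℚ) → ℚ
Σ₁ zero    f = 0ℚ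
Σ₁ (suc n) f = Σ₁ n f + f (suc n)

H : ℕ → ℕ → ℚ
H n m = Σ₁ n (λ j → recip (j Data.Nat.^ m))

{-# OPTIONS --safe #-}
-- Put N = n + 1 and t j = Σ_{ℓ=1}^n 1/(ℓ^j (N−ℓ)^(p−j)).  Because ℓ + (N − ℓ) = N, partial
-- fractions give N/(ℓ^j (N−ℓ)^(p+1−j)) = 1/(ℓ^(j−1) (N−ℓ)^(p+1−j)) + 1/(ℓ^j (N−ℓ)^(p−j)),
-- so the j-th inner sum is t (j−1) + t j and the alternating sum telescopes to
-- t 0 − (−1)^k t k; reversing the order of summation shows t 0 = H_n^(p).  The special
-- cases take n − 1 for n and k = m; for p = 2m + 1 the reflection ℓ ↦ N − ℓ swaps the two
-- halves of the split of N/(ℓ^(m+1) (N−ℓ)^(m+1)), which produces the factor ½.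
module Submission where

open import Defs
open import Data.Nat as ℕ
  using (ℕ; zero; suc; _≤_; _∸_; _^_; z≤n; s≤s; NonZero; >-nonZero)
  renaming (_+_ to _+ℕ_; _*_ to _*ℕ_)
import Data.Nat.Properties as ℕ
open import Data.Nat.Tactic.RingSolver using () renaming (solve-∀ to ℕ-solve-∀)
open import Data.Integer as ℤ using (1ℤ)
import Data.Integer.Properties as ℤ
open import Data.Rational using (ℚ; 1ℚ; ½; _+_; _*_; -_; fromℚᵘ)
open import Data.Rational.Properties
open import Data.Rational.Solver using (module +-*-Solver)
open +-*-Solver
import Data.Rational.Unnormalised as ℚᵘ
open ℚᵘ using (mkℚᵘ; *≡*)
import Data.Rational.Unnormalised.Properties as ℚᵘ
open import Data.Product using (_×_; _,_)
open import Relation.Binary.PropositionalEquality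
open ≡-Reasoning

fromℚᵘ-homo-+ : ∀ p q → fromℚᵘ (p ℚᵘ.+ q) ≡ fromℚᵘ p + fromℚᵘ q
fromℚᵘ-homo-+ p q = toℚᵘ-injective (ℚᵘ.≃-trans (toℚᵘ-fromℚᵘ (p ℚᵘ.+ q)) (ℚᵘ.≃-sym
  (ℚᵘ.≃-trans (toℚᵘ-homo-+ (fromℚᵘ p) (fromℚᵘ q)) (ℚᵘ.+-cong (toℚᵘ-fromℚᵘ p) (toℚᵘ-fromℚᵘ q)))))

fromℚᵘ-homo-* : ∀ p q → fromℚᵘ (p ℚᵘ.* q) ≡ fromℚᵘ p * fromℚᵘ q
fromℚᵘ-homo-* p q = toℚᵘ-injective (ℚᵘ.≃-trans (toℚᵘ-fromℚᵘ (p ℚᵘ.* q)) (ℚᵘ.≃-sym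
  (ℚᵘ.≃-trans (toℚᵘ-homo-* (fromℚᵘ p) (fromℚᵘ q)) (ℚᵘ.*-cong (toℚᵘ-fromℚᵘ p) (toℚᵘ-fromℚᵘ q)))))

-- ℕ→ℚ n and recip (suc d) are definitionally fromℚᵘ of the fractions n/1 and 1/(d+1),
-- so their arithmetic can be checked in ℚᵘ.
ℕ→ℚ-homo-+ : ∀ a b → ℕ→ℚ (a +ℕ b) ≡ ℕ→ℚ a + ℕ→ℚ b
ℕ→ℚ-homo-+ a b = trans
  (fromℚᵘ-cong {mkℚᵘ (ℤ.+ (a +ℕ b)) 0} {mkℚᵘ (ℤ.+ a) 0 ℚᵘ.+ mkℚᵘ (ℤ.+ b) 0}
    (*≡* (cong (ℤ._* 1ℤ) (trans (ℤ.pos-+ a b)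
      (sym (cong₂ ℤ._+_ (ℤ.*-identityʳ (ℤ.+ a)) (ℤ.*-identityʳ (ℤ.+ b))))))))
  (fromℚᵘ-homo-+ (mkℚᵘ (ℤ.+ a) 0) (mkℚᵘ (ℤ.+ b) 0))

recip-inverseʳ : ∀ d .{{_ : NonZero d}} → ℕ→ℚ d * recip d ≡ 1ℚ
recip-inverseʳ (suc d) = trans
  (sym (fromℚᵘ-homo-* (mkℚᵘ (ℤ.+ suc d) 0) (mkℚᵘ (ℤ.+ 1) d)))
  (fromℚᵘ-cong {mkℚᵘ (ℤ.+ suc d) 0 ℚᵘ.* mkℚᵘ (ℤ.+ 1) d} {ℚᵘ.1ℚᵘ}
    (ℚᵘ.*-inverseʳ (mkℚᵘ (ℤ.+ suc d) 0)))

recip-homo-* : ∀ a b → recip (a *ℕ b) ≡ recip a * recip b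
recip-homo-* zero    b                           = sym (*-zeroˡ (recip b))
recip-homo-* (suc a) zero    rewrite ℕ.*-zeroʳ a = sym (*-zeroʳ (recip (suc a)))
recip-homo-* (suc a) (suc b) = trans
  (fromℚᵘ-cong {mkℚᵘ (ℤ.+ 1) (b +ℕ a *ℕ suc b)} {mkℚᵘ (ℤ.+ 1) a ℚᵘ.* mkℚᵘ (ℤ.+ 1) b} (*≡* refl))
  (fromℚᵘ-homo-* (mkℚᵘ (ℤ.+ 1) a) (mkℚᵘ (ℤ.+ 1) b))

partialFractions : ∀ a b i e .{{_ : NonZero a}} .{{_ : NonZero b}} →
  ℕ→ℚ (a +ℕ b) * recip (a ^ suc i *ℕ b ^ suc e)
    ≡ recip (a ^ i *ℕ b ^ suc e) + recip (a ^ suc i *ℕ b ^ e)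
partialFractions a b i e = begin
  ℕ→ℚ (a +ℕ b) * recip (a ^ suc i *ℕ b ^ suc e)
    ≡⟨ cong₂ _*_ (ℕ→ℚ-homo-+ a b) (trans (recip-homo-* (a ^ suc i) (b ^ suc e))
                   (cong₂ _*_ (recip-homo-* a (a ^ i)) (recip-homo-* b (b ^ e)))) ⟩
  (A + B) * (ra * X * (rb * Y))
    ≡⟨ solve 6 (λ A B ra rb X Y → (A :+ B) :* (ra :* X :* (rb :* Y))
                 := (A :* ra) :* (X :* (rb :* Y)) :+ (B :* rb) :* (ra :* X :* Y))
         refl A B ra rb X Y ⟩
  (A * ra) * (X * (rb * Y)) + (B * rb) * (ra * X * Y)
    ≡⟨ cong₂ (λ u v → u * (X * (rb * Y)) + v * (ra * X * Y)) (recip-inverseʳ a) (recip-inverseʳ b) ⟩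
  1ℚ * (X * (rb * Y)) + 1ℚ * (ra * X * Y)
    ≡⟨ cong₂ _+_ (*-identityˡ (X * (rb * Y))) (*-identityˡ (ra * X * Y)) ⟩
  X * (rb * Y) + ra * X * Y
    ≡⟨ cong₂ _+_ (trans (recip-homo-* (a ^ i) (b ^ suc e)) (cong (X *_) (recip-homo-* b (b ^ e))))
                 (trans (recip-homo-* (a ^ suc i) (b ^ e)) (cong (_* Y) (recip-homo-* a (a ^ i)))) ⟨
  recip (a ^ i *ℕ b ^ suc e) + recip (a ^ suc i *ℕ b ^ e) ∎
  where
  A = ℕ→ℚ a
  B = ℕ→ℚ b
  ra = recip a
  rb = recip b
  X = recip (a ^ i)
  Y = recip (b ^ e)

Σ₁-cong : ∀ n {f g : ℕ → ℚ} → (∀ i → 1 ≤ i → i ≤ n → f i ≡ g i) → Σ₁ n f ≡ Σ₁ n g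
Σ₁-cong zero    f≡g = refl
Σ₁-cong (suc n) f≡g = cong₂ _+_
  (Σ₁-cong n (λ i 1≤i i≤n → f≡g i 1≤i (ℕ.m≤n⇒m≤1+n i≤n)))
  (f≡g (suc n) (s≤s z≤n) ℕ.≤-refl)

Σ₁-distrib-+ : ∀ n (f g : ℕ → ℚ) → Σ₁ n (λ i → f i + g i) ≡ Σ₁ n f + Σ₁ n g
Σ₁-distrib-+ zero    f g = refl
Σ₁-distrib-+ (suc n) f g rewrite Σ₁-distrib-+ n f g =
  solve 4 (λ a b c d → (a :+ b) :+ (c :+ d) := (a :+ c) :+ (b :+ d)) refl
    (Σ₁ n f) (Σ₁ n g) (f (suc n)) (g (suc n))

Σ₁-sucˡ : ∀ n (f : ℕ → ℚ) → Σ₁ (suc n) f ≡ f 1 + Σ₁ n (λ i → f (suc i))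
Σ₁-sucˡ zero    f = trans (+-identityˡ (f 1)) (sym (+-identityʳ (f 1)))
Σ₁-sucˡ (suc n) f rewrite Σ₁-sucˡ n f = +-assoc (f 1) (Σ₁ n (λ i → f (suc i))) (f (2 +ℕ n))

Σ₁-reverse : ∀ n (f : ℕ → ℚ) → Σ₁ n f ≡ Σ₁ n (λ i → f (suc n ∸ i))
Σ₁-reverse zero    f = refl
Σ₁-reverse (suc n) f = begin
  Σ₁ n f + f (suc n)                          ≡⟨ +-comm (Σ₁ n f) (f (suc n)) ⟩
  f (suc n) + Σ₁ n f                          ≡⟨ cong (f (suc n) +_) (Σ₁-reverse n f) ⟩
  f (suc n) + Σ₁ n (λ i → f (suc n ∸ i))      ≡⟨ Σ₁-sucˡ n (λ i → f (2 +ℕ n ∸ i)) ⟨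
  Σ₁ (suc n) (λ i → f (2 +ℕ n ∸ i))           ∎

Σ₁-alternating-telescope : ∀ k (t : ℕ → ℚ) →
  Σ₁ k (λ j → sgn (j ∸ 1) * (t (j ∸ 1) + t j)) + sgn k * t k ≡ t 0
Σ₁-alternating-telescope zero    t = trans (+-identityˡ _) (*-identityˡ (t 0))
Σ₁-alternating-telescope (suc k) t = begin
  (S + sgn k * (t k + t (suc k))) + - sgn k * t (suc k)
    ≡⟨ solve 4 (λ S s a b → (S :+ s :* (a :+ b)) :+ (:- s) :* b := S :+ s :* a) refl
         S (sgn k) (t k) (t (suc k)) ⟩
  S + sgn k * t k
    ≡⟨ Σ₁-alternating-telescope k t ⟩
  t 0 ∎
  where S = Σ₁ k (λ j → sgn (j ∸ 1) * (t (j ∸ 1) + t j))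

crossSum : ℕ → ℕ → ℕ → ℚ
crossSum n i e = Σ₁ n (λ ℓ → recip (ℓ ^ i *ℕ (suc n ∸ ℓ) ^ e))

H≡crossSum₀ : ∀ n p → H n p ≡ crossSum n 0 p
H≡crossSum₀ n p = trans (Σ₁-reverse n _)
  (Σ₁-cong n (λ ℓ _ _ → cong recip (sym (ℕ.*-identityˡ ((suc n ∸ ℓ) ^ p)))))

crossSum-comm : ∀ n i e → crossSum n i e ≡ crossSum n e i
crossSum-comm n i e = trans (Σ₁-reverse n _) (Σ₁-cong n reflect)
  where
  reflect : ∀ ℓ → 1 ≤ ℓ → ℓ ≤ n →
    recip ((suc n ∸ ℓ) ^ i *ℕ (suc n ∸ (suc n ∸ ℓ)) ^ e) ≡ recip (ℓ ^ e *ℕ (suc n ∸ ℓ) ^ i)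
  reflect ℓ _ ℓ≤n = cong recip (begin
    (suc n ∸ ℓ) ^ i *ℕ (suc n ∸ (suc n ∸ ℓ)) ^ e
      ≡⟨ cong (λ x → (suc n ∸ ℓ) ^ i *ℕ x ^ e) (ℕ.m∸[m∸n]≡n (ℕ.m≤n⇒m≤1+n ℓ≤n)) ⟩
    (suc n ∸ ℓ) ^ i *ℕ ℓ ^ e
      ≡⟨ ℕ.*-comm ((suc n ∸ ℓ) ^ i) (ℓ ^ e) ⟩
    ℓ ^ e *ℕ (suc n ∸ ℓ) ^ i ∎)

crossSum-split : ∀ n i e →
  Σ₁ n (λ ℓ → ℕ→ℚ (suc n) * recip (ℓ ^ suc i *ℕ (suc n ∸ ℓ) ^ suc e))
    ≡ crossSum n i (suc e) + crossSum n (suc i) e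
crossSum-split n i e = trans (Σ₁-cong n split) (Σ₁-distrib-+ n _ _)
  where
  split : ∀ ℓ → 1 ≤ ℓ → ℓ ≤ n →
    ℕ→ℚ (suc n) * recip (ℓ ^ suc i *ℕ (suc n ∸ ℓ) ^ suc e)
      ≡ recip (ℓ ^ i *ℕ (suc n ∸ ℓ) ^ suc e) + recip (ℓ ^ suc i *ℕ (suc n ∸ ℓ) ^ e)
  split ℓ 1≤ℓ ℓ≤n = trans
    (cong (λ N → ℕ→ℚ N * recip (ℓ ^ suc i *ℕ (suc n ∸ ℓ) ^ suc e))
      (sym (ℕ.m+[n∸m]≡n (ℕ.m≤n⇒m≤1+n ℓ≤n))))
    (partialFractions ℓ (suc n ∸ ℓ) i e
      {{>-nonZero 1≤ℓ}} {{>-nonZero (ℕ.m<n⇒0<n∸m (s≤s ℓ≤n))}})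

crossSum-step : ∀ n p i → suc i ≤ p →
  Σ₁ n (λ ℓ → ℕ→ℚ (suc n) * recip (ℓ ^ suc i *ℕ (suc n ∸ ℓ) ^ (p ∸ i)))
    ≡ crossSum n i (p ∸ i) + crossSum n (suc i) (p ∸ suc i)
crossSum-step n p i i<p rewrite ℕ.+-∸-assoc 1 i<p = crossSum-split n i (p ∸ suc i)

harmonic-expansion : ∀ n p k → k ≤ p →
  H n p ≡ Σ₁ k (λ j → sgn (j ∸ 1) * Σ₁ n (λ ℓ →
              ℕ→ℚ (suc n) * recip (ℓ ^ j *ℕ (suc n ∸ ℓ) ^ (suc p ∸ j))))
          + sgn k * crossSum n k (p ∸ k)
harmonic-expansion n p k k≤p = begin
  H n p
    ≡⟨ H≡crossSum₀ n p ⟩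
  t 0
    ≡⟨ Σ₁-alternating-telescope k t ⟨
  Σ₁ k (λ j → sgn (j ∸ 1) * (t (j ∸ 1) + t j)) + sgn k * t k
    ≡⟨ cong (_+ sgn k * t k) (Σ₁-cong k term) ⟩
  Σ₁ k (λ j → sgn (j ∸ 1) * Σ₁ n (λ ℓ →
          ℕ→ℚ (suc n) * recip (ℓ ^ j *ℕ (suc n ∸ ℓ) ^ (suc p ∸ j))))
    + sgn k * t k ∎
  where
  t : ℕ → ℚ
  t j = crossSum n j (p ∸ j)
  term : ∀ j → 1 ≤ j → j ≤ k → sgn (j ∸ 1) * (t (j ∸ 1) + t j)
    ≡ sgn (j ∸ 1) * Σ₁ n (λ ℓ → ℕ→ℚ (suc n) * recip (ℓ ^ j *ℕ (suc n ∸ ℓ) ^ (suc p ∸ j)))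
  term (suc i) _ i<k = cong (sgn i *_) (sym (crossSum-step n p i (ℕ.≤-trans i<k k≤p)))

crossSum-middle : ∀ n m →
  crossSum n m (suc m)
    ≡ ½ * Σ₁ n (λ ℓ → ℕ→ℚ (suc n) * recip (ℓ ^ suc m *ℕ (suc n ∸ ℓ) ^ suc m))
crossSum-middle n m = begin
  x                                   ≡⟨ solve 1 (λ x → x := con ½ :* (x :+ x)) refl x ⟩
  ½ * (x + x)                         ≡⟨ cong (λ y → ½ * (x + y)) (crossSum-comm n m (suc m)) ⟩
  ½ * (x + crossSum n (suc m) m)      ≡⟨ cong (½ *_) (crossSum-split n m m) ⟨
  ½ * Σ₁ n (λ ℓ → ℕ→ℚ (suc n) * recip (ℓ ^ suc m *ℕ (suc n ∸ ℓ) ^ suc m)) ∎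
  where x = crossSum n m (suc m)

2m+1≡m+[1+m] : ∀ m → 2 *ℕ m +ℕ 1 ≡ m +ℕ suc m
2m+1≡m+[1+m] = ℕ-solve-∀

[2m+1]∸m≡1+m : ∀ m → 2 *ℕ m +ℕ 1 ∸ m ≡ suc m
[2m+1]∸m≡1+m m = trans (cong (_∸ m) (2m+1≡m+[1+m] m)) (ℕ.m+n∸m≡n m (suc m))

2m∸m≡m : ∀ m → 2 *ℕ m ∸ m ≡ m
2m∸m≡m m = trans (ℕ.m+n∸m≡n m (m +ℕ 0)) (ℕ.+-identityʳ m)

H-expansion : ∀ p n k → k ≤ p →
    H n p ≡
    Σ₁ k (λ j → sgn (j ∸ 1) * Σ₁ n (λ ℓ →
        ℕ→ℚ (n +ℕ 1) * recip ((ℓ ^ j) *ℕ ((n +ℕ 1 ∸ ℓ) ^ (p +ℕ 1 ∸ j)))))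
    + sgn k * Σ₁ n (λ ℓ → recip ((ℓ ^ k) *ℕ ((n +ℕ 1 ∸ ℓ) ^ (p ∸ k))))
H-expansion p n k k≤p rewrite ℕ.+-comm n 1 | ℕ.+-comm p 1 = harmonic-expansion n p k k≤p

H-odd-expansion : (m n : ℕ) → 1 ≤ n →
    H n (2 *ℕ m +ℕ 1) ≡
    Σ₁ m (λ j → sgn (j ∸ 1) * Σ₁ (n ∸ 1) (λ k →
        ℕ→ℚ n * recip ((k ^ j) *ℕ ((n ∸ k) ^ (2 *ℕ m +ℕ 2 ∸ j)))))
    + sgn m * ½ * Σ₁ (n ∸ 1) (λ k → ℕ→ℚ n * recip ((k ^ (m +ℕ 1)) *ℕ ((n ∸ k) ^ (m +ℕ 1))))
    + recip (n ^ (2 *ℕ m +ℕ 1))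
H-odd-expansion m (suc n) _ rewrite ℕ.+-suc (2 *ℕ m) 1 | ℕ.+-comm m 1 =
  cong (_+ recip (suc n ^ p)) (begin
    H n p
      ≡⟨ harmonic-expansion n p m (ℕ.≤-trans (ℕ.m≤m+n m (m +ℕ 0)) (ℕ.m≤m+n (2 *ℕ m) 1)) ⟩
    S + sgn m * crossSum n m (p ∸ m)
      ≡⟨ cong (λ e → S + sgn m * crossSum n m e) ([2m+1]∸m≡1+m m) ⟩
    S + sgn m * crossSum n m (suc m)
      ≡⟨ cong (λ x → S + sgn m * x) (crossSum-middle n m) ⟩
    S + sgn m * (½ * M)
      ≡⟨ cong (S +_) (*-assoc (sgn m) ½ M) ⟨
    S + sgn m * ½ * M ∎)
  where
  p = 2 *ℕ m +ℕ 1
  S = Σ₁ m (λ j → sgn (j ∸ 1) * Σ₁ n (λ k → ℕ→ℚ (suc n) * recip (k ^ j *ℕ (suc n ∸ k) ^ (suc p ∸ j))))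
  M = Σ₁ n (λ k → ℕ→ℚ (suc n) * recip (k ^ suc m *ℕ (suc n ∸ k) ^ suc m))

H-even-expansion : (m n : ℕ) → 1 ≤ n →
    H n (2 *ℕ m) ≡
    Σ₁ m (λ j → sgn (j ∸ 1) * Σ₁ (n ∸ 1) (λ k →
        ℕ→ℚ n * recip ((k ^ j) *ℕ ((n ∸ k) ^ (2 *ℕ m +ℕ 1 ∸ j)))))
    + sgn m * Σ₁ (n ∸ 1) (λ j → recip ((j ^ m) *ℕ ((n ∸ j) ^ m)))
    + recip (n ^ (2 *ℕ m))
H-even-expansion m (suc n) _ rewrite ℕ.+-comm (2 *ℕ m) 1 =
  cong (_+ recip (suc n ^ (2 *ℕ m)))
    (trans (harmonic-expansion n (2 *ℕ m) m (ℕ.m≤m+n m (m +ℕ 0)))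
      (cong (λ e → S + sgn m * crossSum n m e) (2m∸m≡m m)))
  where
  S = Σ₁ m (λ j → sgn (j ∸ 1) * Σ₁ n (λ k →
        ℕ→ℚ (suc n) * recip (k ^ j *ℕ (suc n ∸ k) ^ (suc (2 *ℕ m) ∸ j))))

corollary1 :
    ((p n k : ℕ) → 1 ≤ p → 1 ≤ n → k ≤ p →
      H n p ≡
        Σ₁ k (λ j → sgn (j ∸ 1) * Σ₁ n (λ ℓ →
            ℕ→ℚ (n +ℕ 1) * recip ((ℓ ^ j) *ℕ ((n +ℕ 1 ∸ ℓ) ^ (p +ℕ 1 ∸ j)))))
        + sgn k * Σ₁ n (λ ℓ → recip ((ℓ ^ k) *ℕ ((n +ℕ 1 ∸ ℓ) ^ (p ∸ k)))))
    ×
    ((m n : ℕ) → 1 ≤ n →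
      H n (2 *ℕ m +ℕ 1) ≡
        Σ₁ m (λ j → sgn (j ∸ 1) * Σ₁ (n ∸ 1) (λ k →
            ℕ→ℚ n * recip ((k ^ j) *ℕ ((n ∸ k) ^ (2 *ℕ m +ℕ 2 ∸ j)))))
        + sgn m * ½ * Σ₁ (n ∸ 1) (λ k → ℕ→ℚ n * recip ((k ^ (m +ℕ 1)) *ℕ ((n ∸ k) ^ (m +ℕ 1))))
        + recip (n ^ (2 *ℕ m +ℕ 1)))
    ×
    ((m n : ℕ) → 1 ≤ n →
      H n (2 *ℕ m) ≡
        Σ₁ m (λ j → sgn (j ∸ 1) * Σ₁ (n ∸ 1) (λ k →
            ℕ→ℚ n * recip ((k ^ j) *ℕ ((n ∸ k) ^ (2 *ℕ m +ℕ 1 ∸ j)))))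
        + sgn m * Σ₁ (n ∸ 1) (λ j → recip ((j ^ m) *ℕ ((n ∸ j) ^ m)))
        + recip (n ^ (2 *ℕ m)))
corollary1 = (λ p n k _ _ → H-expansion p n k) , H-odd-expansion , H-even-expansion
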